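{- Let $x[1..n]$ be a framed word as described in the context, let $k\in[2,n-1]$, and let $l=\mathit{prev}_{ -1}[k]$ and $r=\mathit{next}_{ -1}[k]$. Then: (1) if $\mathrm{lce}(l,k)=\mathrm{lce}(k,r)$, then $\mathrm{lce}(l,r)\ge\mathrm{lce}(k,r)$, and either $\mathit{prev}_{ -1}[r]=l$ or $\mathit{next}_{ -1}[l]=r$; (2) if $\mathrm{lce}(l,k)<\mathrm{lce}(k,r)$, then $\mathrm{lce}(l,r)=\mathrm{lce}(l,k)$ and $\mathit{prev}_{ -1}[r]=l$; (3) if $\mathrm{lce}(l,k)>\mathrm{lce}(k,r)$, then $\mathrm{lce}(l,r)=\mathrm{lce}(k,r)$ and $\mathit{next}_{ -1}[l]=r$.
   Context: Let $(\Sigma,<)$ be a totally ordered alphabet. The lexicographic order $\prec$ on words is: $u\prec v$ iff either $v=uw$ for some non-empty word $w$, or $u=ary$, $v=asy'$ for words $a,y,y'$ and letters $r<s$. A framed word is a word $x[1..n]$ ($n\ge 2$) with $x[1]=\#$, $x[n]=\$$ and $x[2..n-1]\in\Sigma^*$, where the order on $\Sigma$ is extended by $\# > \$ > a$ for all $a\in\Sigma$. For $1\le i\le n$, $x_i=x[i..n]$; $\mathrm{lce}(i,j)$ is the length of the longest common prefix of $x_i$ and $x_j$. The next greater suffix array is $\mathit{next}_{ -1}[i]=\min\{j\in(i,n]\mid x_j\succ x_i\}$, with $\mathit{next}_{ -1}[1]=\mathit{next}_{ -1}[n]=n+1$; the previous greater suffix array is $\mathit{prev}_{ -1}[i]=\max\{j\in[1,i)\mid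 x_j\succ x_i\}$, with $\mathit{prev}_{ -1}[1]=0$ and $\mathit{prev}_{ -1}[n]=1$. -}

module Defs where

open import Data.Nat using (ℕ; zero; suc; _+_; _∸_; _<_; _≤_; _≟_; _<?_)
open import Data.List using (List; []; _∷_; _++_; map; length; drop; [_])
open import Data.Bool using (Bool; true; false)
open import Relation.Binary.Definitions using (Tri; tri<; tri≈; tri>)
open import Relation.Binary.Structures using (IsStrictTotalOrder)
open import Relation.Binary.PropositionalEquality using (_≡_; refl; cong)
open import Relation.Nullary using (Dec; yes; no; ¬_)
open import Data.Empty using (⊥)
open import Data.Product using (_×_; _,_)
import Data.List.Relation.Binary.Lex.Strict as Lex

-- Extended alphabet: letters of Σ, plus $ and #, with  a < $ < #  for every letter a.
data Ext (A : Set) : Set where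
  lett   : A → Ext A
  dollar : Ext A
  hash   : Ext A

-- The framed word  x = # w $  (positions 1..n, n = |w| + 2).
frame : {A : Set} → List A → List (Ext A)
frame w = hash ∷ (map lett w ++ [ dollar ])

module Framed {A : Set} {_<ₐ_ : A → A → Set}
              (sto : IsStrictTotalOrder _≡_ _<ₐ_) where

  open IsStrictTotalOrder sto using (compare)

  data _<ₑ_ : Ext A → Ext A → Set where
    ll : ∀ {a b} → a <ₐ b → lett a <ₑ lett b
    ld : ∀ {a} → lett a <ₑ dollar
    lh : ∀ {a} → lett a <ₑ hash
    dh : dollar <ₑ hash

  _≟ₑ_ : (c d : Ext A) → Dec (c ≡ d)
  lett a ≟ₑ lett b with compare a b
  ... | tri< _ a≢b _ = no λ { refl → a≢b refl }
  ... | tri≈ _ refl _ = yes refl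
  ... | tri> _ a≢b _ = no λ { refl → a≢b refl }
  lett _ ≟ₑ dollar = no λ ()
  lett _ ≟ₑ hash = no λ ()
  dollar ≟ₑ lett _ = no λ ()
  dollar ≟ₑ dollar = yes refl
  dollar ≟ₑ hash = no λ ()
  hash ≟ₑ lett _ = no λ ()
  hash ≟ₑ dollar = no λ ()
  hash ≟ₑ hash = yes refl

  _<ₑ?_ : (c d : Ext A) → Dec (c <ₑ d)
  lett a <ₑ? lett b with compare a b
  ... | tri< a<b _ _ = yes (ll a<b)
  ... | tri≈ ¬a<b _ _ = no λ { (ll p) → ¬a<b p }
  ... | tri> ¬a<b _ _ = no λ { (ll p) → ¬a<b p }
  lett _ <ₑ? dollar = yes ld
  lett _ <ₑ? hash = yes lh
  dollar <ₑ? lett _ = no λ ()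
  dollar <ₑ? dollar = no λ ()
  dollar <ₑ? hash = yes dh
  hash <ₑ? lett _ = no λ ()
  hash <ₑ? dollar = no λ ()
  hash <ₑ? hash = no λ ()

  _≺_ : List (Ext A) → List (Ext A) → Set
  _≺_ = Lex.Lex-< _≡_ _<ₑ_

  _≻_ : List (Ext A) → List (Ext A) → Set
  u ≻ v = v ≺ u

  _≻?_ : (u v : List (Ext A)) → Dec (u ≻ v)
  u ≻? v = Lex.<-decidable _≟ₑ_ _<ₑ?_ v u

  lcp : List (Ext A) → List (Ext A) → ℕ
  lcp (c ∷ u) (d ∷ v) with c ≟ₑ d
  ... | yes _ = suc (lcp u v)
  ... | no _  = 0
  lcp _ _ = 0

  module Word (w : List A) where
    x : List (Ext A)
    x = frame w

    n : ℕ
    n = length x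

    -- suffix x_i = x[i..n]  (1-indexed)
    suf : ℕ → List (Ext A)
    suf i = drop (i ∸ 1) x

    lce : ℕ → ℕ → ℕ
    lce i j = lcp (suf i) (suf j)

    searchUp : ℕ → ℕ → ℕ → ℕ → ℕ
    searchUp i s zero d = d
    searchUp i s (suc c) d with suf s ≻? suf i
    ... | yes _ = s
    ... | no _  = searchUp i (suc s) c d

    searchDown : ℕ → ℕ → ℕ
    searchDown i zero = 0
    searchDown i (suc c) with suf (suc c) ≻? suf i
    ... | yes _ = suc c
    ... | no _  = searchDown i c

    -- next_{-1}[i] = min { j ∈ (i, n] | x_j ≻ x_i },  next[1] = next[n] = n+1
    next : ℕ → ℕ
    next i with i ≟ 1 | i ≟ n
    ... | yes _ | _ = suc n
    ... | no _ | yes _ = suc n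
    ... | no _ | no _ = searchUp i (suc i) (n ∸ i) (suc n)

    -- prev_{-1}[i] = max { j ∈ [1, i) | x_j ≻ x_i },  prev[1] = 0, prev[n] = 1
    prev : ℕ → ℕ
    prev i with i ≟ 1 | i ≟ n
    ... | yes _ | _ = 0
    ... | no _ | yes _ = 1
    ... | no _ | no _ = searchDown i (i ∸ 1)

-- Every position strictly between l and r other than k carries
-- a suffix below x_k, while x_l and x_r lie above x_k; so whichever of x_l, x_r is smaller has
-- the other as its nearest greater suffix on that side. The lce equalities are the isosceles
-- property of the ultrametric 2^(-lcp), and when lce(l,k) ≠ lce(k,r) the word sharing the
-- longer prefix with x_k compares to the other one exactly as x_k does.

module Submission where

open import Defs
open import Data.Nat using (ℕ; _≤_; _<_; _>_; _≥_; _∸_)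
open import Data.List using (List)
open import Data.Product using (_×_)
open import Data.Sum using (_⊎_)
open import Relation.Binary.PropositionalEquality using (_≡_)
open import Relation.Binary.Structures using (IsStrictTotalOrder)

open import Data.Nat using (zero; suc; z≤n; s≤s; s≤s⁻¹; _+_; _⊓_; _≟_)
open import Data.Nat.Properties
open import Data.List using ([]; _∷_; [_]; _++_; map; length; drop)
open import Data.List.Properties using (length-drop; length-++; length-map)
import Data.List.Relation.Binary.Lex.Strict as Lex
open import Data.List.Relation.Binary.Pointwise using (Pointwise-≡⇒≡; ≡⇒Pointwise-≡)
open import Data.Product using (∃₂; _,_)
open import Data.Sum using (inj₁; inj₂)
import Data.Sum as Sum
open import Function using (_∘_)
open import Relation.Nullary using (¬_; yes; no; contradiction)
open import Relation.Binary.Definitions using (Trichotomous; tri<; tri≈; tri>)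
open import Relation.Binary.PropositionalEquality
  using (refl; sym; trans; cong; subst; subst₂; _≢_; resp₂; isEquivalence; module ≡-Reasoning)

NoneIn : (ℕ → Set) → ℕ → ℕ → Set
NoneIn P a b = ∀ m → a ≤ m → m < b → ¬ P m

module _ {P : ℕ → Set} where

  NoneIn-empty : ∀ {a} → NoneIn P a a
  NoneIn-empty m a≤m m<a = contradiction a≤m (<⇒≱ m<a)

  NoneIn-extendˡ : ∀ {a b} → ¬ P a → NoneIn P (suc a) b → NoneIn P a b
  NoneIn-extendˡ ¬Pa none m a≤m m<b with m≤n⇒m<n∨m≡n a≤m
  ... | inj₁ a<m  = none m a<m m<b
  ... | inj₂ refl = ¬Pa

  NoneIn-extendʳ : ∀ {a b} → ¬ P b → NoneIn P a b → NoneIn P a (suc b)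
  NoneIn-extendʳ ¬Pb none m a≤m m<1+b with m≤n⇒m<n∨m≡n (s≤s⁻¹ m<1+b)
  ... | inj₁ m<b  = none m a≤m m<b
  ... | inj₂ refl = ¬Pb

  NoneIn-≤ : ∀ {a b j} → NoneIn P a b → a ≤ j → P j → b ≤ j
  NoneIn-≤ none a≤j Pj = ≮⇒≥ λ j<b → none _ a≤j j<b Pj

  NoneIn-< : ∀ {a b j} → NoneIn P a b → j < b → P j → j < a
  NoneIn-< none j<b Pj = ≰⇒> λ a≤j → none _ a≤j j<b Pj

module FramedWords {A : Set} {_<ₐ_ : A → A → Set} (sto : IsStrictTotalOrder _≡_ _<ₐ_) where
  open Framed sto
  private module A = IsStrictTotalOrder sto

  <ₑ-isStrictTotalOrder : IsStrictTotalOrder _≡_ _<ₑ_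
  <ₑ-isStrictTotalOrder = record
    { isStrictPartialOrder = record
      { isEquivalence = isEquivalence
      ; irrefl        = irrefl
      ; trans         = transitive
      ; <-resp-≈      = resp₂ _<ₑ_
      }
    ; compare = compareₑ
    }
    where
    irrefl : ∀ {c d} → c ≡ d → ¬ (c <ₑ d)
    irrefl refl (ll a<a) = A.irrefl refl a<a

    transitive : ∀ {c d e} → c <ₑ d → d <ₑ e → c <ₑ e
    transitive (ll a<b) (ll b<c) = ll (A.trans a<b b<c)
    transitive (ll _)   ld       = ld
    transitive (ll _)   lh       = lh
    transitive ld       dh       = lh

    compareₑ : Trichotomous _≡_ _<ₑ_
    compareₑ (lett a) (lett b) with A.compare a b
    ... | tri< a<b a≢b b≮a = tri< (ll a<b) (λ { refl → a≢b refl }) (λ { (ll b<a) → b≮a b<a })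
    ... | tri≈ a≮b refl _  = tri≈ (λ { (ll a<a) → a≮b a<a }) refl (λ { (ll a<a) → a≮b a<a })
    ... | tri> a≮b a≢b b<a = tri> (λ { (ll a<b) → a≮b a<b }) (λ { refl → a≢b refl }) (ll b<a)
    compareₑ (lett _) dollar   = tri< ld (λ ()) (λ ())
    compareₑ (lett _) hash     = tri< lh (λ ()) (λ ())
    compareₑ dollar   (lett _) = tri> (λ ()) (λ ()) ld
    compareₑ dollar   dollar   = tri≈ (λ ()) refl (λ ())
    compareₑ dollar   hash     = tri< dh (λ ()) (λ ())
    compareₑ hash     (lett _) = tri> (λ ()) (λ ()) lh
    compareₑ hash     dollar   = tri> (λ ()) (λ ()) dh
    compareₑ hash     hash     = tri≈ (λ ()) refl (λ ())

  private module E = IsStrictTotalOrder <ₑ-isStrictTotalOrder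

  -- The library's lexicographic order is total up to pointwise equality of words, which is _≡_.
  ≺-isStrictTotalOrder : IsStrictTotalOrder _≡_ _≺_
  ≺-isStrictTotalOrder = record
    { isStrictPartialOrder = record
      { isEquivalence = isEquivalence
      ; irrefl        = λ { refl → Lex.<-irreflexive E.irrefl (≡⇒Pointwise-≡ refl) }
      ; trans         = Lex.<-transitive isEquivalence (resp₂ _<ₑ_) E.trans
      ; <-resp-≈      = resp₂ _≺_
      }
    ; compare = compare
    }
    where
    compare : Trichotomous _≡_ _≺_
    compare u v with Lex.<-compare sym E.compare u v
    ... | tri< u≺v u≉v v⊀u = tri< u≺v (u≉v ∘ ≡⇒Pointwise-≡) v⊀u
    ... | tri≈ u⊀v u≈v v⊀u = tri≈ u⊀v (Pointwise-≡⇒≡ u≈v) v⊀u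
    ... | tri> u⊀v u≉v v≺u = tri> u⊀v (u≉v ∘ ≡⇒Pointwise-≡) v≺u

  open IsStrictTotalOrder ≺-isStrictTotalOrder public
    using () renaming (trans to ≺-trans; asym to ≺-asym; compare to ≺-compare)

  ≺-connex : ∀ {u v} → u ≢ v → u ≺ v ⊎ v ≺ u
  ≺-connex {u} {v} u≢v with ≺-compare u v
  ... | tri< u≺v _ _ = inj₁ u≺v
  ... | tri≈ _ u≡v _ = contradiction u≡v u≢v
  ... | tri> _ _ v≺u = inj₂ v≺u

  lcp-∷ : ∀ c u v → lcp (c ∷ u) (c ∷ v) ≡ suc (lcp u v)
  lcp-∷ c u v with c ≟ₑ c
  ... | yes _  = refl
  ... | no c≢c = contradiction refl c≢c

  lcp-comm : ∀ u v → lcp u v ≡ lcp v u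
  lcp-comm []      []      = refl
  lcp-comm []      (_ ∷ _) = refl
  lcp-comm (_ ∷ _) []      = refl
  lcp-comm (c ∷ u) (d ∷ v) with c ≟ₑ d | d ≟ₑ c
  ... | yes _    | yes _    = cong suc (lcp-comm u v)
  ... | no _     | no _     = refl
  ... | yes refl | no c≢c   = contradiction refl c≢c
  ... | no c≢d   | yes refl = contradiction refl c≢d

  lcp-⊓-≤ : ∀ u t v → lcp u t ⊓ lcp t v ≤ lcp u v
  lcp-⊓-≤ []      _       _       = z≤n
  lcp-⊓-≤ (_ ∷ _) []      _       = z≤n
  lcp-⊓-≤ (_ ∷ _) (_ ∷ _) []      = ≤-reflexive (⊓-zeroʳ _)
  lcp-⊓-≤ (a ∷ u) (b ∷ t) (c ∷ v) with a ≟ₑ b | b ≟ₑ c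
  ... | yes refl | yes refl = subst (_ ≤_) (sym (lcp-∷ a u v)) (s≤s (lcp-⊓-≤ u t v))
  ... | yes _    | no _     = z≤n
  ... | no _     | _        = z≤n

  lcp-isoscelesˡ : ∀ u t v → lcp u t < lcp t v → lcp u v ≡ lcp u t
  lcp-isoscelesˡ u t v ut<tv = ≤-antisym uv≤ut ut≤uv
    where
    ut≤uv : lcp u t ≤ lcp u v
    ut≤uv = subst (_≤ lcp u v) (m≤n⇒m⊓n≡m (<⇒≤ ut<tv)) (lcp-⊓-≤ u t v)
    uv≤ut : lcp u v ≤ lcp u t
    uv≤ut = ≮⇒≥ λ ut<uv →
      <⇒≱ (⊓-glb ut<uv (subst (lcp u t <_) (lcp-comm t v) ut<tv)) (lcp-⊓-≤ u v t)

  lcp-isoscelesʳ : ∀ u t v → lcp t v < lcp u t → lcp u v ≡ lcp t v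
  lcp-isoscelesʳ u t v tv<ut = begin
    lcp u v ≡⟨ lcp-comm u v ⟩
    lcp v u ≡⟨ lcp-isoscelesˡ v t u (subst₂ _<_ (lcp-comm t v) (lcp-comm u t) tv<ut) ⟩
    lcp v t ≡⟨ lcp-comm v t ⟩
    lcp t v ∎
    where open ≡-Reasoning

  ≺-lcp-< : ∀ {t u v} → t ≺ u → lcp t u < lcp t v → v ≺ u
  ≺-lcp-< Lex.halt ()
  ≺-lcp-< {_ ∷ _} {_ ∷ _} {[]}    (Lex.this _) ()
  ≺-lcp-< {c ∷ t} {_ ∷ u} {e ∷ v} (Lex.this c<d) tu<tv with c ≟ₑ e
  ... | yes refl = Lex.this c<d
  ... | no _     = contradiction tu<tv n≮0
  ≺-lcp-< {_ ∷ _} {_ ∷ _} {[]}    (Lex.next refl _) ()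
  ≺-lcp-< {c ∷ t} {_ ∷ u} {e ∷ v} (Lex.next refl t≺u) tu<tv with c ≟ₑ e
  ... | yes refl = Lex.next refl (≺-lcp-< t≺u (s≤s⁻¹ (subst (_< _) (lcp-∷ c t u) tu<tv)))
  ... | no _     = contradiction tu<tv n≮0

  length-letters : ∀ (v : List A) → length (map lett v ++ [ dollar ]) ≡ suc (length v)
  length-letters v =
    trans (length-++ (map lett v)) (trans (cong (_+ 1) (length-map lett v)) (+-comm _ 1))

  drop-letters : ∀ (v : List A) m → m < length v →
                 ∃₂ λ a ys → drop m (map lett v ++ [ dollar ]) ≡ lett a ∷ ys
  drop-letters (a ∷ _) zero    _   = a , _ , refl
  drop-letters (_ ∷ v) (suc m) m<v = drop-letters v m (s≤s⁻¹ m<v)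

  drop-letters-end : ∀ (v : List A) → drop (length v) (map lett v ++ [ dollar ]) ≡ [ dollar ]
  drop-letters-end []      = refl
  drop-letters-end (_ ∷ v) = drop-letters-end v

  module Positions (w : List A) where
    open Word w

    infix 4 _⊏_
    _⊏_ : ℕ → ℕ → Set
    i ⊏ j = suf i ≺ suf j

    n≡2+∣w∣ : n ≡ suc (suc (length w))
    n≡2+∣w∣ = cong suc (length-letters w)

    suf-letter : ∀ {j} → 2 ≤ j → j < n → ∃₂ λ a ys → suf j ≡ lett a ∷ ys
    suf-letter {suc (suc m)} (s≤s (s≤s _)) j<n =
      drop-letters w m (s≤s⁻¹ (subst (suc (suc m) ≤_) (length-letters w) (s≤s⁻¹ j<n)))

    suf-last : suf n ≡ [ dollar ]
    suf-last = subst (λ m → suf m ≡ [ dollar ]) (sym n≡2+∣w∣) (drop-letters-end w)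

    -- suf 0 = suf 1, so injectivity needs positive positions.
    suf-injective : ∀ {i j} → 1 ≤ i → 1 ≤ j → i ≤ n → j ≤ n → suf i ≡ suf j → i ≡ j
    suf-injective {suc i} {suc j} _ _ i<n j<n eq = cong suc (∸-cancelˡ-≡ (<⇒≤ i<n) (<⇒≤ j<n) (begin
      n ∸ i              ≡⟨ length-drop i x ⟨
      length (drop i x)  ≡⟨ cong length eq ⟩
      length (drop j x)  ≡⟨ length-drop j x ⟩
      n ∸ j              ∎))
      where open ≡-Reasoning

    ⊏-first : ∀ {j} → 2 ≤ j → j ≤ n → j ⊏ 1
    ⊏-first 2≤j j≤n with m≤n⇒m<n∨m≡n j≤n
    ... | inj₂ refl = subst (_≺ suf 1) (sym suf-last) (Lex.this dh)
    ... | inj₁ j<n  with suf-letter 2≤j j<n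
    ...   | _ , _ , eq = subst (_≺ suf 1) (sym eq) (Lex.this lh)

    ⊏-last : ∀ {j} → 2 ≤ j → j < n → j ⊏ n
    ⊏-last 2≤j j<n with suf-letter 2≤j j<n
    ... | _ , _ , eq = subst₂ _≺_ (sym eq) (sym suf-last) (Lex.this ld)

    ⊏-connex : ∀ {i j} → 1 ≤ i → 1 ≤ j → i ≤ n → j ≤ n → i ≢ j → i ⊏ j ⊎ j ⊏ i
    ⊏-connex 1≤i 1≤j i≤n j≤n i≢j = ≺-connex (i≢j ∘ suf-injective 1≤i 1≤j i≤n j≤n)

    record IsNext (i r : ℕ) : Set where
      constructor isNext
      field
        after   : i < r
        bounded : r ≤ n
        greater : i ⊏ r
        first   : NoneIn (i ⊏_) (suc i) r

    record IsPrev (i l : ℕ) : Set where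
      constructor isPrev
      field
        positive : 1 ≤ l
        before   : l < i
        greater  : i ⊏ l
        last     : NoneIn (i ⊏_) (suc l) i

    IsNext-unique : ∀ {i r r′} → IsNext i r → IsNext i r′ → r ≡ r′
    IsNext-unique (isNext i<r _ i⊏r first) (isNext i<r′ _ i⊏r′ first′) =
      ≤-antisym (NoneIn-≤ first i<r′ i⊏r′) (NoneIn-≤ first′ i<r i⊏r)

    IsPrev-unique : ∀ {i l l′} → IsPrev i l → IsPrev i l′ → l ≡ l′
    IsPrev-unique (isPrev _ l<i i⊏l last) (isPrev _ l′<i i⊏l′ last′) =
      ≤-antisym (s≤s⁻¹ (NoneIn-< last′ l<i i⊏l)) (s≤s⁻¹ (NoneIn-< last l′<i i⊏l′))

    searchUp-first : ∀ {i j} s c d → s ≤ j → j < s + c → i ⊏ j →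
                     let r = searchUp i s c d in s ≤ r × i ⊏ r × NoneIn (i ⊏_) s r
    searchUp-first s zero _ s≤j j<s+0 _ = contradiction (subst (_ <_) (+-identityʳ s) j<s+0) (≤⇒≯ s≤j)
    searchUp-first {i} s (suc c) d s≤j j<s+c i⊏j with suf s ≻? suf i
    ... | yes i⊏s = ≤-refl , i⊏s , NoneIn-empty
    ... | no i⋢s with m≤n⇒m<n∨m≡n s≤j
    ...   | inj₂ refl = contradiction i⊏j i⋢s
    ...   | inj₁ s<j with searchUp-first (suc s) c d s<j (subst (_<_ _) (+-suc s c) j<s+c) i⊏j
    ...     | s<r , i⊏r , none = <⇒≤ s<r , i⊏r , NoneIn-extendˡ i⋢s none

    searchDown-last : ∀ {i j} c → 1 ≤ j → j ≤ c → i ⊏ j →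
                      let l = searchDown i c in l ≤ c × i ⊏ l × NoneIn (i ⊏_) (suc l) (suc c)
    searchDown-last zero (s≤s _) ()
    searchDown-last {i} (suc c) 1≤j j≤c i⊏j with suf (suc c) ≻? suf i
    ... | yes i⊏c = ≤-refl , i⊏c , NoneIn-empty
    ... | no i⋢c with m≤n⇒m<n∨m≡n j≤c
    ...   | inj₂ refl = contradiction i⊏j i⋢c
    ...   | inj₁ j<c with searchDown-last c 1≤j (s≤s⁻¹ j<c) i⊏j
    ...     | l≤c , i⊏l , none = m≤n⇒m≤1+n l≤c , i⊏l , NoneIn-extendʳ i⋢c none

    searchUp-IsNext : ∀ {i j} → i < j → j ≤ n → i ⊏ j → IsNext i (searchUp i (suc i) (n ∸ i) (suc n))
    searchUp-IsNext {i} {j} i<j j≤n i⊏j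
      with searchUp-first (suc i) (n ∸ i) (suc n) i<j (s≤s j≤n′) i⊏j
      where
      j≤n′ : j ≤ i + (n ∸ i)
      j≤n′ = subst (j ≤_) (sym (m+[n∸m]≡n (<⇒≤ (<-≤-trans i<j j≤n)))) j≤n
    ... | i<r , i⊏r , first = isNext i<r (≤-trans (NoneIn-≤ first i<j i⊏j) j≤n) i⊏r first

    searchDown-IsPrev : ∀ {i j} → 1 ≤ j → j ≤ i → suc i ⊏ j → IsPrev (suc i) (searchDown (suc i) i)
    searchDown-IsPrev 1≤j j≤i i⊏j with searchDown-last _ 1≤j j≤i i⊏j
    ... | l≤i , i⊏l , last = isPrev (≤-trans 1≤j (s≤s⁻¹ (NoneIn-< last (s≤s j≤i) i⊏j))) (s≤s l≤i) i⊏l last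

    next-IsNext : ∀ {k} → 2 ≤ k → k < n → IsNext k (next k)
    next-IsNext {k} 2≤k k<n with k ≟ 1 | k ≟ n
    ... | yes refl | _        = contradiction 2≤k (<-irrefl refl)
    ... | no _     | yes refl = contradiction k<n (<-irrefl refl)
    ... | no _     | no _     = searchUp-IsNext k<n ≤-refl (⊏-last 2≤k k<n)

    prev-IsPrev : ∀ {k} → 2 ≤ k → k < n → IsPrev k (prev k)
    prev-IsPrev {suc k} 2≤k k<n with suc k ≟ 1 | suc k ≟ n
    ... | yes refl | _        = contradiction 2≤k (<-irrefl refl)
    ... | no _     | yes refl = contradiction k<n (<-irrefl refl)
    ... | no _     | no _     = searchDown-IsPrev ≤-refl (s≤s⁻¹ 2≤k) (⊏-first 2≤k (<⇒≤ k<n))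

    IsNext⇒next≡ : ∀ {i r} → IsNext i r → next i ≡ r
    IsNext⇒next≡ {i} {r} isNextᵢ@(isNext i<r r≤n i⊏r _) with i ≟ 1 | i ≟ n
    ... | yes refl | _        = contradiction i⊏r (≺-asym (⊏-first i<r r≤n))
    ... | no _     | yes refl = contradiction (<-≤-trans i<r r≤n) (<-irrefl refl)
    ... | no _     | no _     = IsNext-unique (searchUp-IsNext i<r r≤n i⊏r) isNextᵢ

    -- The convention prev n = 1 agrees with IsPrev, since x_1 = # is the only suffix above x_n = $.
    IsPrev⇒prev≡ : ∀ {i l} → IsPrev i l → prev i ≡ l
    IsPrev⇒prev≡ {zero} (isPrev _ () _ _)
    IsPrev⇒prev≡ {suc i} {l} isPrevᵢ@(isPrev 1≤l l<i i⊏l _) with suc i ≟ 1 | suc i ≟ n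
    ... | yes refl | _        = contradiction (≤-<-trans 1≤l l<i) (<-irrefl refl)
    ... | no _     | yes refl = 1≡l
      where
      1≡l : 1 ≡ l
      1≡l with l ≟ 1
      ... | yes l≡1 = sym l≡1
      ... | no l≢1  = contradiction i⊏l (≺-asym (⊏-last (≤∧≢⇒< 1≤l (l≢1 ∘ sym)) l<i))
    ... | no _     | no _     = IsPrev-unique (searchDown-IsPrev 1≤l (s≤s⁻¹ l<i) i⊏l) isPrevᵢ

    -- Every position strictly between l and r other than k is below k,
    -- so nothing there lies above a suffix that lies above x_k.
    module _ {k l r} (prevₖ : IsPrev k l) (nextₖ : IsNext k r) where
      private
        open IsPrev prevₖ renaming (greater to k⊏l)
        open IsNext nextₖ renaming (greater to k⊏r)
        l<r : l < r
        l<r = <-trans before after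

      window-below : ∀ {j} → l < j → j < r → j ≢ k → j ⊏ k
      window-below {j} l<j j<r j≢k
        with ⊏-connex (≤-trans positive (<⇒≤ l<j)) (≤-trans positive (<⇒≤ before))
                      (≤-trans (<⇒≤ j<r) bounded) (≤-trans (<⇒≤ after) bounded) j≢k
      ... | inj₁ j⊏k = j⊏k
      ... | inj₂ k⊏j with <-cmp j k
      ...   | tri< j<k _ _ = contradiction k⊏j (last _ l<j j<k)
      ...   | tri≈ _ j≡k _ = contradiction j≡k j≢k
      ...   | tri> _ _ k<j = contradiction k⊏j (first _ k<j j<r)

      window-not-above : ∀ {t} → k ⊏ t → NoneIn (t ⊏_) (suc l) r
      window-not-above {t} k⊏t j l<j j<r t⊏j with j ≟ k
      ... | yes refl = ≺-asym k⊏t t⊏j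
      ... | no j≢k   = ≺-asym k⊏t (≺-trans t⊏j (window-below l<j j<r j≢k))

      next-of-prev : l ⊏ r → next l ≡ r
      next-of-prev l⊏r = IsNext⇒next≡ (isNext l<r bounded l⊏r (window-not-above {l} k⊏l))

      prev-of-next : r ⊏ l → prev r ≡ l
      prev-of-next r⊏l = IsPrev⇒prev≡ (isPrev positive l<r r⊏l (window-not-above {r} k⊏r))

      prev-of-next⊎next-of-prev : prev r ≡ l ⊎ next l ≡ r
      prev-of-next⊎next-of-prev =
        Sum.swap (Sum.map next-of-prev prev-of-next
          (⊏-connex positive (≤-trans positive (<⇒≤ l<r)) (≤-trans (<⇒≤ l<r) bounded) bounded
                    (<⇒≢ l<r)))

lemma12 : {A : Set} {_<ₐ_ : A → A → Set} (sto : IsStrictTotalOrder _≡_ _<ₐ_)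
          (w : List A) (k : ℕ) →
          let open Framed sto in
          let open Word w in
          2 ≤ k → k ≤ n ∸ 1 →
          ((lce (prev k) k ≡ lce k (next k) →
             (lce (prev k) (next k) ≥ lce k (next k))
             × ((prev (next k) ≡ prev k) ⊎ (next (prev k) ≡ next k)))
          × (lce (prev k) k < lce k (next k) →
             (lce (prev k) (next k) ≡ lce (prev k) k) × (prev (next k) ≡ prev k))
          × (lce (prev k) k > lce k (next k) →
             (lce (prev k) (next k) ≡ lce k (next k)) × (next (prev k) ≡ next k)))
lemma12 sto w k 2≤k k≤n∸1 = equal , shorter , longer
  where
  open Framed sto
  open Word w
  open FramedWords sto
  open Positions w

  k<n : k < n
  k<n = m≤pred[n]⇒suc[m]≤n k≤n∸1

  prevₖ : IsPrev k (prev k)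
  prevₖ = prev-IsPrev 2≤k k<n

  nextₖ : IsNext k (next k)
  nextₖ = next-IsNext 2≤k k<n

  xₗ xₖ xᵣ : List (Ext _)
  xₗ = suf (prev k)
  xₖ = suf k
  xᵣ = suf (next k)

  equal : lce (prev k) k ≡ lce k (next k) →
          (lce (prev k) (next k) ≥ lce k (next k)) × ((prev (next k) ≡ prev k) ⊎ (next (prev k) ≡ next k))
  equal eq = subst (_≤ lcp xₗ xᵣ) (trans (cong (_⊓ lcp xₖ xᵣ) eq) (⊓-idem (lcp xₖ xᵣ))) (lcp-⊓-≤ xₗ xₖ xᵣ)
           , prev-of-next⊎next-of-prev prevₖ nextₖ

  shorter : lce (prev k) k < lce k (next k) →
            (lce (prev k) (next k) ≡ lce (prev k) k) × (prev (next k) ≡ prev k)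
  shorter lt = lcp-isoscelesˡ xₗ xₖ xᵣ lt
             , prev-of-next prevₖ nextₖ (≺-lcp-< (IsPrev.greater prevₖ) (subst (_< lcp xₖ xᵣ) (lcp-comm xₗ xₖ) lt))

  longer : lce (prev k) k > lce k (next k) →
           (lce (prev k) (next k) ≡ lce k (next k)) × (next (prev k) ≡ next k)
  longer gt = lcp-isoscelesʳ xₗ xₖ xᵣ gt
            , next-of-prev prevₖ nextₖ (≺-lcp-< (IsNext.greater nextₖ) (subst (lcp xₖ xᵣ <_) (lcp-comm xₗ xₖ) gt))
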